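{- Let $G$ be a cubic graph that has four 1-factors $M_1, \dots, M_4$ with $|E(G) - \bigcup_{i=1}^4 M_i| = k \geq 0$. If $\bigcap_{i=1}^4 M_i = \emptyset$, then $G$ has a 4-cycle cover of length $\frac{4}{3}|E(G)| + 4k$.
   Context: Graphs are finite, may have parallel edges, but no loops. A 1-factor is a spanning 1-regular subgraph, identified with its edge set. A cycle is a subgraph all of whose vertices have even degree. A 4-cycle cover is a set of at most 4 cycles such that every edge lies in at least one of them; its length is $\sum_C |E(C)|$. -}

module Defs where

open import Data.Nat using (ℕ; _+_; _≤_)
open import Data.Nat.Divisibility using (_∣_)
open import Data.Fin using (Fin)
open import Data.Fin.Properties using (_≟_)
open import Data.Fin.Subset using (Subset; ∣_∣; _∩_; _∈_; ⊤)
open import Data.Bool using (Bool; _∨_)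
open import Data.Vec using (tabulate)
open import Data.List using (List; length; map)
open import Data.Nat.ListAction using (sum)
open import Data.List.Relation.Unary.All using (All)
open import Data.List.Relation.Unary.Any using (Any)
open import Data.Product using (Σ; _×_)
open import Relation.Binary.PropositionalEquality using (_≡_; _≢_)
open import Relation.Nullary.Decidable using (⌊_⌋)

record Graph : Set where
  field
    n m   : ℕ
    src   : Fin m → Fin n
    tgt   : Fin m → Fin n
    noLoop : ∀ e → src e ≢ tgt e

module _ (G : Graph) where
  open Graph G

  EdgeSet : Set
  EdgeSet = Subset m

  incident : Fin m → Fin n → Bool
  incident e v = ⌊ src e ≟ v ⌋ ∨ ⌊ tgt e ≟ v ⌋

  ∂ : Fin n → EdgeSet
  ∂ v = tabulate (λ e → incident e v)

  -- degree of v in the spanning subgraph with edge set S (no loops, so each edge counts once)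
  deg : EdgeSet → Fin n → ℕ
  deg S v = ∣ S ∩ ∂ v ∣

  Cubic : Set
  Cubic = ∀ v → deg ⊤ v ≡ 3

  IsOneFactor : EdgeSet → Set
  IsOneFactor M = ∀ v → deg M v ≡ 1

  -- cycle: subgraph all of whose vertices have even degree (identified with its edge set)
  IsCycle : EdgeSet → Set
  IsCycle C = ∀ v → 2 ∣ deg C v

  Is4CycleCover : List EdgeSet → Set
  Is4CycleCover Cs = length Cs ≤ 4 × All IsCycle Cs × (∀ e → Any (e ∈_) Cs)

  coverLength : List EdgeSet → ℕ
  coverLength Cs = sum (map ∣_∣ Cs)

-- Let C_i be the complement of the symmetric difference of the three 1-factors other than
-- M_i. At every vertex C_i has degree ≡ 3 + 1 + 1 + 1 ≡ 0 (mod 2), so it is a cycle. An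
-- edge lying in exactly j of the M_i lies in exactly j of the C_i when 1 ≤ j ≤ 3 (j = 4 is
-- excluded) and in all four when j = 0. Hence the C_i cover E(G) with total length
-- Σ|M_i| + 4k, and each |M_i| = |E(G)|/3 by the handshake lemma.
module Submission where

open import Defs
open import Data.Nat using (ℕ; _+_; _*_)
open import Data.Fin.Subset using (∣_∣; _∩_; _∪_; ∁; ⊥)
open import Data.List using (List)
open import Data.Product using (Σ; _×_)
open import Relation.Binary.PropositionalEquality using (_≡_)

open import Data.Nat using (zero; suc; parity)
open import Data.Nat.Properties
  using (+-suc; *-zeroʳ; *-identityʳ; *-distribˡ-+; *-cancelˡ-≡; ≤-refl; +-0-commutativeMonoid)
open import Data.Nat.Divisibility using (_∣_; divides)
open import Data.Nat.Solver using (module +-*-Solver)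
open import Data.Parity.Base as ℙ using (0ℙ)
import Data.Parity.Properties as ℙ
import Data.Nat.Properties as ℕ
open import Algebra.Properties.CommutativeSemigroup ℕ.+-commutativeSemigroup using (interchange)
open import Data.Bool using (Bool; true; false; not; _∧_; _∨_; _xor_)
open import Data.Bool.Properties using (∧-distribʳ-xor)
open import Data.Fin using (Fin; zero; suc)
open import Data.Fin.Properties using (_≟_; suc-injective)
open import Data.Fin.Subset using (Subset; ⊤; _∈_)
open import Data.Fin.Subset.Properties using (∣⊤∣≡n)
open import Data.Vec using ([]; _∷_; here; there; tabulate)
import Data.Vec as Vec
open import Data.Vec.Properties using (∷-injectiveˡ; ∷-injectiveʳ)
open import Data.List using ([]; _∷_; length; map; zipWith; replicate)
open import Data.Nat.ListAction using (sum)
open import Data.List.Relation.Unary.All using (All; []; _∷_)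
open import Data.List.Relation.Unary.Any using (Any; here; there)
open import Data.Product using (_,_)
open import Relation.Nullary.Decidable using (⌊_⌋; yes; no; ⌊⌋-map′)
open import Relation.Nullary.Negation using (contradiction)
open import Relation.Binary.PropositionalEquality
  using (refl; sym; trans; cong; cong₂; _≢_; module ≡-Reasoning)
open import Algebra.Properties.CommutativeMonoid.Sum +-0-commutativeMonoid
  using (sum-syntax; ∑-distrib-+; sum-cong-≗; sum-replicate-zero)

open +-*-Solver

toℕ : Bool → ℕ
toℕ true  = 1
toℕ false = 0

∣x∷p∣≡toℕx+∣p∣ : ∀ {m} x (p : Subset m) → ∣ x ∷ p ∣ ≡ toℕ x + ∣ p ∣
∣x∷p∣≡toℕx+∣p∣ true  p = refl
∣x∷p∣≡toℕx+∣p∣ false p = refl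

infixr 6 _⊕_

_⊕_ : ∀ {m} → Subset m → Subset m → Subset m
_⊕_ = Vec.zipWith _xor_

∁p≡⊤⊕p : ∀ {m} (p : Subset m) → ∁ p ≡ ⊤ ⊕ p
∁p≡⊤⊕p []      = refl
∁p≡⊤⊕p (x ∷ p) = cong (not x ∷_) (∁p≡⊤⊕p p)

∩-distribʳ-⊕ : ∀ {m} (p q r : Subset m) → (p ⊕ q) ∩ r ≡ (p ∩ r) ⊕ (q ∩ r)
∩-distribʳ-⊕ []      []      []      = refl
∩-distribʳ-⊕ (x ∷ p) (y ∷ q) (z ∷ r) =
  cong₂ _∷_ (∧-distribʳ-xor z x y) (∩-distribʳ-⊕ p q r)

∣p⊕q∣+2∣p∩q∣≡∣p∣+∣q∣ : ∀ {m} (p q : Subset m) → ∣ p ⊕ q ∣ + 2 * ∣ p ∩ q ∣ ≡ ∣ p ∣ + ∣ q ∣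
∣p⊕q∣+2∣p∩q∣≡∣p∣+∣q∣ []          []          = refl
∣p⊕q∣+2∣p∩q∣≡∣p∣+∣q∣ (true  ∷ p) (true  ∷ q) = begin
  ∣ p ⊕ q ∣ + 2 * suc ∣ p ∩ q ∣     ≡⟨ solve 2 (λ x y → x :+ con 2 :* (con 1 :+ y) := con 2 :+ (x :+ con 2 :* y))
                                          refl ∣ p ⊕ q ∣ ∣ p ∩ q ∣ ⟩
  2 + (∣ p ⊕ q ∣ + 2 * ∣ p ∩ q ∣)   ≡⟨ cong (2 +_) (∣p⊕q∣+2∣p∩q∣≡∣p∣+∣q∣ p q) ⟩
  2 + (∣ p ∣ + ∣ q ∣)               ≡⟨ cong suc (sym (+-suc ∣ p ∣ ∣ q ∣)) ⟩
  suc ∣ p ∣ + suc ∣ q ∣             ∎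
  where open ≡-Reasoning
∣p⊕q∣+2∣p∩q∣≡∣p∣+∣q∣ (true  ∷ p) (false ∷ q) = cong suc (∣p⊕q∣+2∣p∩q∣≡∣p∣+∣q∣ p q)
∣p⊕q∣+2∣p∩q∣≡∣p∣+∣q∣ (false ∷ p) (true  ∷ q) =
  trans (cong suc (∣p⊕q∣+2∣p∩q∣≡∣p∣+∣q∣ p q)) (sym (+-suc ∣ p ∣ ∣ q ∣))
∣p⊕q∣+2∣p∩q∣≡∣p∣+∣q∣ (false ∷ p) (false ∷ q) = ∣p⊕q∣+2∣p∩q∣≡∣p∣+∣q∣ p q

parity-∣p⊕q∣ : ∀ {m} (p q : Subset m) → parity ∣ p ⊕ q ∣ ≡ parity ∣ p ∣ ℙ.+ parity ∣ q ∣
parity-∣p⊕q∣ p q = begin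
  parity ∣ p ⊕ q ∣                            ≡⟨ ℙ.+-identityʳ _ ⟨
  parity ∣ p ⊕ q ∣ ℙ.+ 0ℙ                     ≡⟨ cong (parity ∣ p ⊕ q ∣ ℙ.+_) (ℙ.*-homo-* 2 ∣ p ∩ q ∣) ⟨
  parity ∣ p ⊕ q ∣ ℙ.+ parity (2 * ∣ p ∩ q ∣) ≡⟨ ℙ.+-homo-+ ∣ p ⊕ q ∣ (2 * ∣ p ∩ q ∣) ⟨
  parity (∣ p ⊕ q ∣ + 2 * ∣ p ∩ q ∣)          ≡⟨ cong parity (∣p⊕q∣+2∣p∩q∣≡∣p∣+∣q∣ p q) ⟩
  parity (∣ p ∣ + ∣ q ∣)                      ≡⟨ ℙ.+-homo-+ ∣ p ∣ ∣ q ∣ ⟩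
  parity ∣ p ∣ ℙ.+ parity ∣ q ∣               ∎
  where open ≡-Reasoning

parity≡0ℙ⇒2∣ : ∀ n → parity n ≡ 0ℙ → 2 ∣ n
parity≡0ℙ⇒2∣ zero          _  = divides 0 refl
parity≡0ℙ⇒2∣ (suc (suc n)) eq with divides q n≡q*2 ← parity≡0ℙ⇒2∣ n eq =
  divides (suc q) (cong (2 +_) n≡q*2)

∑-const : ∀ n d → ∑[ _ < n ] d ≡ n * d
∑-const zero    d = refl
∑-const (suc n) d = cong (d +_) (∑-const n d)

∑-indicator : ∀ {n} (a : Fin n) → ∑[ v < n ] toℕ ⌊ a ≟ v ⌋ ≡ 1
∑-indicator {suc n} zero    = cong suc (sum-replicate-zero n)
∑-indicator {suc n} (suc a) =
  trans (sum-cong-≗ (λ v → cong toℕ (⌊⌋-map′ (cong suc) suc-injective (a ≟ v)))) (∑-indicator a)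

∑-indicator-pair : ∀ {n} {a b : Fin n} → a ≢ b → ∑[ v < n ] toℕ (⌊ a ≟ v ⌋ ∨ ⌊ b ≟ v ⌋) ≡ 2
∑-indicator-pair {n} {a} {b} a≢b = begin
  ∑[ v < n ] toℕ (⌊ a ≟ v ⌋ ∨ ⌊ b ≟ v ⌋)             ≡⟨ sum-cong-≗ toℕ-∨-disjoint ⟩
  ∑[ v < n ] (toℕ ⌊ a ≟ v ⌋ + toℕ ⌊ b ≟ v ⌋)         ≡⟨ ∑-distrib-+ {n} _ _ ⟩
  ∑[ v < n ] toℕ ⌊ a ≟ v ⌋ + ∑[ v < n ] toℕ ⌊ b ≟ v ⌋ ≡⟨ cong₂ _+_ (∑-indicator a) (∑-indicator b) ⟩
  2                                                  ∎
  where
  open ≡-Reasoning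
  toℕ-∨-disjoint : ∀ v → toℕ (⌊ a ≟ v ⌋ ∨ ⌊ b ≟ v ⌋) ≡ toℕ ⌊ a ≟ v ⌋ + toℕ ⌊ b ≟ v ⌋
  toℕ-∨-disjoint v with a ≟ v | b ≟ v
  ... | yes refl | yes refl = contradiction refl a≢b
  ... | yes _    | no _     = refl
  ... | no _     | yes _    = refl
  ... | no _     | no _     = refl

∑-∣∩∣-double-count : ∀ {m n r} (g : Fin m → Fin n → Bool) → (∀ e → ∑[ v < n ] toℕ (g e v) ≡ r) →
                     (S : Subset m) → ∑[ v < n ] ∣ S ∩ tabulate (λ e → g e v) ∣ ≡ r * ∣ S ∣
∑-∣∩∣-double-count {n = n} {r} g ∑g≡r [] = trans (sum-replicate-zero n) (sym (*-zeroʳ r))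
∑-∣∩∣-double-count {n = n} {r} g ∑g≡r (s ∷ S) = begin
  ∑[ v < n ] ∣ (s ∧ g zero v) ∷ S ∩ others v ∣
    ≡⟨ sum-cong-≗ (λ v → ∣x∷p∣≡toℕx+∣p∣ (s ∧ g zero v) (S ∩ others v)) ⟩
  ∑[ v < n ] (toℕ (s ∧ g zero v) + ∣ S ∩ others v ∣)
    ≡⟨ ∑-distrib-+ {n} _ _ ⟩
  ∑[ v < n ] toℕ (s ∧ g zero v) + ∑[ v < n ] ∣ S ∩ others v ∣
    ≡⟨ cong₂ _+_ (first s) (∑-∣∩∣-double-count (λ e → g (suc e)) (λ e → ∑g≡r (suc e)) S) ⟩
  r * toℕ s + r * ∣ S ∣
    ≡⟨ *-distribˡ-+ r (toℕ s) ∣ S ∣ ⟨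
  r * (toℕ s + ∣ S ∣)
    ≡⟨ cong (r *_) (∣x∷p∣≡toℕx+∣p∣ s S) ⟨
  r * ∣ s ∷ S ∣
    ∎
  where
  open ≡-Reasoning
  others : Fin n → Subset _
  others v = tabulate (λ e → g (suc e) v)
  first : ∀ s → ∑[ v < n ] toℕ (s ∧ g zero v) ≡ r * toℕ s
  first true  = trans (∑g≡r zero) (sym (*-identityʳ r))
  first false = trans (sum-replicate-zero n) (sym (*-zeroʳ r))

∑∣∣-zipWith-∷ : ∀ {m} (bs : List Bool) (ps : List (Subset m)) → length bs ≡ length ps →
                sum (map ∣_∣ (zipWith _∷_ bs ps)) ≡ sum (map toℕ bs) + sum (map ∣_∣ ps)
∑∣∣-zipWith-∷ []       []       _  = refl
∑∣∣-zipWith-∷ (b ∷ bs) (p ∷ ps) eq = begin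
  ∣ b ∷ p ∣ + sum (map ∣_∣ (zipWith _∷_ bs ps))
    ≡⟨ cong₂ _+_ (∣x∷p∣≡toℕx+∣p∣ b p) (∑∣∣-zipWith-∷ bs ps (ℕ.suc-injective eq)) ⟩
  (toℕ b + ∣ p ∣) + (sum (map toℕ bs) + sum (map ∣_∣ ps))
    ≡⟨ interchange (toℕ b) ∣ p ∣ (sum (map toℕ bs)) (sum (map ∣_∣ ps)) ⟩
  (toℕ b + sum (map toℕ bs)) + (∣ p ∣ + sum (map ∣_∣ ps))
    ∎
  where open ≡-Reasoning

Any-∈-zero : ∀ {m} (bs : List Bool) (ps : List (Subset m)) → length bs ≡ length ps →
             Any (_≡ true) bs → Any (zero ∈_) (zipWith _∷_ bs ps)
Any-∈-zero (b ∷ bs) (p ∷ ps) eq (here refl) = here here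
Any-∈-zero (b ∷ bs) (p ∷ ps) eq (there b∈) = there (Any-∈-zero bs ps (ℕ.suc-injective eq) b∈)

Any-∈-suc : ∀ {m} {e : Fin m} (bs : List Bool) (ps : List (Subset m)) → length bs ≡ length ps →
            Any (e ∈_) ps → Any (suc e ∈_) (zipWith _∷_ bs ps)
Any-∈-suc (b ∷ bs) (p ∷ ps) eq (here e∈p)  = here (there e∈p)
Any-∈-suc (b ∷ bs) (p ∷ ps) eq (there e∈) = there (Any-∈-suc bs ps (ℕ.suc-injective eq) e∈)

∑toℕ≢0⇒Any-true : ∀ bs → sum (map toℕ bs) ≢ 0 → Any (_≡ true) bs
∑toℕ≢0⇒Any-true []          ∑≢0 = contradiction refl ∑≢0
∑toℕ≢0⇒Any-true (true  ∷ _)  _   = here refl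
∑toℕ≢0⇒Any-true (false ∷ bs) ∑≢0 = there (∑toℕ≢0⇒Any-true bs ∑≢0)

complementCycles : ∀ {m} → (a b c d : Subset m) → List (Subset m)
complementCycles a b c d = ∁ (b ⊕ c ⊕ d) ∷ ∁ (a ⊕ c ⊕ d) ∷ ∁ (a ⊕ b ⊕ d) ∷ ∁ (a ⊕ b ⊕ c) ∷ []

weightedFactors : ∀ {m} → (a b c d : Subset m) → List (Subset m)
weightedFactors a b c d = a ∷ b ∷ c ∷ d ∷ replicate 4 (∁ (a ∪ b ∪ c ∪ d))

complementCycleBits : (p q r s : Bool) → List Bool
complementCycleBits p q r s =
  not (q xor r xor s) ∷ not (p xor r xor s) ∷ not (p xor q xor s) ∷ not (p xor q xor r) ∷ []

weightedFactorBits : (p q r s : Bool) → List Bool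
weightedFactorBits p q r s = p ∷ q ∷ r ∷ s ∷ replicate 4 (not (p ∨ q ∨ r ∨ s))

edge-multiplicity : ∀ p q r s → p ∧ q ∧ r ∧ s ≡ false →
  sum (map toℕ (complementCycleBits p q r s)) ≡ sum (map toℕ (weightedFactorBits p q r s))
edge-multiplicity true  true  true  true  ()
edge-multiplicity true  true  true  false _ = refl
edge-multiplicity true  true  false true  _ = refl
edge-multiplicity true  true  false false _ = refl
edge-multiplicity true  false true  true  _ = refl
edge-multiplicity true  false true  false _ = refl
edge-multiplicity true  false false true  _ = refl
edge-multiplicity true  false false false _ = refl
edge-multiplicity false true  true  true  _ = refl
edge-multiplicity false true  true  false _ = refl
edge-multiplicity false true  false true  _ = refl
edge-multiplicity false true  false false _ = refl
edge-multiplicity false false true  true  _ = refl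
edge-multiplicity false false true  false _ = refl
edge-multiplicity false false false true  _ = refl
edge-multiplicity false false false false _ = refl

∑weightedFactorBits≢0 : ∀ p q r s → sum (map toℕ (weightedFactorBits p q r s)) ≢ 0
∑weightedFactorBits≢0 true  _     _     _     ()
∑weightedFactorBits≢0 false true  _     _     ()
∑weightedFactorBits≢0 false false true  _     ()
∑weightedFactorBits≢0 false false false true  ()
∑weightedFactorBits≢0 false false false false ()

∑∣complementCycles∣ : ∀ {m} (a b c d : Subset m) → a ∩ b ∩ c ∩ d ≡ ⊥ →
  sum (map ∣_∣ (complementCycles a b c d)) ≡ sum (map ∣_∣ (weightedFactors a b c d))
∑∣complementCycles∣ []      []      []      []      _         = refl
∑∣complementCycles∣ (p ∷ a) (q ∷ b) (r ∷ c) (s ∷ d) abcd≡⊥ = begin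
  sum (map ∣_∣ (complementCycles (p ∷ a) (q ∷ b) (r ∷ c) (s ∷ d)))
    ≡⟨ ∑∣∣-zipWith-∷ (complementCycleBits p q r s) (complementCycles a b c d) refl ⟩
  sum (map toℕ (complementCycleBits p q r s)) + sum (map ∣_∣ (complementCycles a b c d))
    ≡⟨ cong₂ _+_ (edge-multiplicity p q r s (∷-injectiveˡ abcd≡⊥))
                 (∑∣complementCycles∣ a b c d (∷-injectiveʳ abcd≡⊥)) ⟩
  sum (map toℕ (weightedFactorBits p q r s)) + sum (map ∣_∣ (weightedFactors a b c d))
    ≡⟨ ∑∣∣-zipWith-∷ (weightedFactorBits p q r s) (weightedFactors a b c d) refl ⟨
  sum (map ∣_∣ (weightedFactors (p ∷ a) (q ∷ b) (r ∷ c) (s ∷ d)))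
    ∎
  where open ≡-Reasoning

complementCycles-cover : ∀ {m} (a b c d : Subset m) → a ∩ b ∩ c ∩ d ≡ ⊥ →
                         ∀ e → Any (e ∈_) (complementCycles a b c d)
complementCycles-cover (p ∷ a) (q ∷ b) (r ∷ c) (s ∷ d) abcd≡⊥ zero =
  Any-∈-zero (complementCycleBits p q r s) (complementCycles a b c d) refl
    (∑toℕ≢0⇒Any-true _ (λ ∑≡0 → ∑weightedFactorBits≢0 p q r s
      (trans (sym (edge-multiplicity p q r s (∷-injectiveˡ abcd≡⊥))) ∑≡0)))
complementCycles-cover (p ∷ a) (q ∷ b) (r ∷ c) (s ∷ d) abcd≡⊥ (suc e) =
  Any-∈-suc (complementCycleBits p q r s) (complementCycles a b c d) refl
    (complementCycles-cover a b c d (∷-injectiveʳ abcd≡⊥) e)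

module _ (G : Graph) where
  open Graph G using (n; m; noLoop)

  handshake : (S : EdgeSet G) → ∑[ v < n ] deg G S v ≡ 2 * ∣ S ∣
  handshake = ∑-∣∩∣-double-count (incident G) (λ e → ∑-indicator-pair (noLoop e))

  regular⇒2∣S∣≡n*d : ∀ S {d} → (∀ v → deg G S v ≡ d) → 2 * ∣ S ∣ ≡ n * d
  regular⇒2∣S∣≡n*d S {d} S-regular =
    trans (sym (handshake S)) (trans (sum-cong-≗ S-regular) (∑-const n d))

  cubic⇒3∣M∣≡m : Cubic G → ∀ M → IsOneFactor G M → 3 * ∣ M ∣ ≡ m
  cubic⇒3∣M∣≡m cubic M oneFactor = *-cancelˡ-≡ _ _ 2 (begin
    2 * (3 * ∣ M ∣)  ≡⟨ solve 1 (λ x → con 2 :* (con 3 :* x) := con 3 :* (con 2 :* x)) refl ∣ M ∣ ⟩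
    3 * (2 * ∣ M ∣)  ≡⟨ cong (3 *_) (regular⇒2∣S∣≡n*d M oneFactor) ⟩
    3 * (n * 1)      ≡⟨ solve 1 (λ x → con 3 :* (x :* con 1) := x :* con 3) refl n ⟩
    n * 3            ≡⟨ regular⇒2∣S∣≡n*d ⊤ cubic ⟨
    2 * ∣ ⊤ {m} ∣    ≡⟨ cong (2 *_) (∣⊤∣≡n m) ⟩
    2 * m            ∎)
    where open ≡-Reasoning

  parity-deg-⊕ : ∀ S T v → parity (deg G (S ⊕ T) v) ≡ parity (deg G S v) ℙ.+ parity (deg G T v)
  parity-deg-⊕ S T v =
    trans (cong (λ X → parity ∣ X ∣) (∩-distribʳ-⊕ S T (∂ G v))) (parity-∣p⊕q∣ (S ∩ ∂ G v) (T ∩ ∂ G v))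

  ∁⊕-isCycle : Cubic G → ∀ A B D → IsOneFactor G A → IsOneFactor G B → IsOneFactor G D →
               IsCycle G (∁ (A ⊕ B ⊕ D))
  ∁⊕-isCycle cubic A B D fA fB fD v = parity≡0ℙ⇒2∣ _ (begin
    parity (deg G (∁ (A ⊕ B ⊕ D)) v)
      ≡⟨ cong (λ X → parity (deg G X v)) (∁p≡⊤⊕p (A ⊕ B ⊕ D)) ⟩
    parity (deg G (⊤ ⊕ A ⊕ B ⊕ D) v)
      ≡⟨ trans (parity-deg-⊕ ⊤ (A ⊕ B ⊕ D) v) (cong (parity (deg G ⊤ v) ℙ.+_)
           (trans (parity-deg-⊕ A (B ⊕ D) v) (cong (parity (deg G A v) ℙ.+_) (parity-deg-⊕ B D v)))) ⟩
    parity (deg G ⊤ v) ℙ.+ (parity (deg G A v) ℙ.+ (parity (deg G B v) ℙ.+ parity (deg G D v)))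
      ≡⟨ cong₂ ℙ._+_ (cong parity (cubic v)) (cong₂ ℙ._+_ (cong parity (fA v))
           (cong₂ ℙ._+_ (cong parity (fB v)) (cong parity (fD v)))) ⟩
    parity 3 ℙ.+ (parity 1 ℙ.+ (parity 1 ℙ.+ parity 1))
      ≡⟨⟩
    0ℙ ∎)
    where open ≡-Reasoning

mainTheorem18 : (G : Graph) → Cubic G →
    (M₁ M₂ M₃ M₄ : EdgeSet G) →
    IsOneFactor G M₁ → IsOneFactor G M₂ → IsOneFactor G M₃ → IsOneFactor G M₄ →
    (k : ℕ) → ∣ ∁ (M₁ ∪ M₂ ∪ M₃ ∪ M₄) ∣ ≡ k →
    M₁ ∩ M₂ ∩ M₃ ∩ M₄ ≡ ⊥ →
    Σ (List (EdgeSet G)) (λ Cs → Is4CycleCover G Cs × 3 * coverLength G Cs ≡ 4 * Graph.m G + 12 * k)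
mainTheorem18 G cubic M₁ M₂ M₃ M₄ f₁ f₂ f₃ f₄ k ∣uncovered∣≡k ⋂M≡⊥ =
  complementCycles M₁ M₂ M₃ M₄ ,
  (≤-refl , cycles , complementCycles-cover M₁ M₂ M₃ M₄ ⋂M≡⊥) ,
  (begin
    3 * sum (map ∣_∣ (complementCycles M₁ M₂ M₃ M₄))
      ≡⟨ cong (3 *_) (∑∣complementCycles∣ M₁ M₂ M₃ M₄ ⋂M≡⊥) ⟩
    3 * sum (map ∣_∣ (weightedFactors M₁ M₂ M₃ M₄))
      ≡⟨ solve 5 (λ a b c d x → con 3 :* (a :+ (b :+ (c :+ (d :+ (x :+ (x :+ (x :+ (x :+ con 0))))))))
                    := con 3 :* a :+ con 3 :* b :+ con 3 :* c :+ con 3 :* d :+ con 12 :* x)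
           refl (∣ M₁ ∣) (∣ M₂ ∣) (∣ M₃ ∣) (∣ M₄ ∣) (∣ ∁ (M₁ ∪ M₂ ∪ M₃ ∪ M₄) ∣) ⟩
    3 * ∣ M₁ ∣ + 3 * ∣ M₂ ∣ + 3 * ∣ M₃ ∣ + 3 * ∣ M₄ ∣ + 12 * ∣ ∁ (M₁ ∪ M₂ ∪ M₃ ∪ M₄) ∣
      ≡⟨ cong₂ _+_ (cong₂ _+_ (cong₂ _+_ (cong₂ _+_ (size M₁ f₁) (size M₂ f₂)) (size M₃ f₃)) (size M₄ f₄))
                   (cong (12 *_) ∣uncovered∣≡k) ⟩
    m + m + m + m + 12 * k
      ≡⟨ solve 2 (λ x y → x :+ x :+ x :+ x :+ con 12 :* y := con 4 :* x :+ con 12 :* y) refl m k ⟩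
    4 * m + 12 * k
      ∎)
  where
  open ≡-Reasoning
  open Graph G using (m)
  size : ∀ M → IsOneFactor G M → 3 * ∣ M ∣ ≡ m
  size = cubic⇒3∣M∣≡m G cubic
  cycles : All (IsCycle G) (complementCycles M₁ M₂ M₃ M₄)
  cycles = ∁⊕-isCycle G cubic M₂ M₃ M₄ f₂ f₃ f₄ ∷ ∁⊕-isCycle G cubic M₁ M₃ M₄ f₁ f₃ f₄ ∷
           ∁⊕-isCycle G cubic M₁ M₂ M₄ f₁ f₂ f₄ ∷ ∁⊕-isCycle G cubic M₁ M₂ M₃ f₁ f₂ f₃ ∷ []
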